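{- Let $\varphi\in\mathrm{LTL}(\mathbf{F},\mathbf{G},\land)$ be a flat formula and $w\in(2^{AP})^\omega$. Each of the following two properties is equivalent to $w\models\varphi$: (1) there exists $\varphi'$ such that $\varphi\xrightarrow{w(0)}\varphi'$ in $\mathcal A$ and $w(1)w(2)\cdots\models\varphi'$; (2) there exist $i\in\mathbb{N}$ and $\varphi'$ such that $\varphi\xrightarrow{w(0)\cdots w(i-1)}\varphi'$ in $\mathcal A$, $\#_{\mathbf F}(\varphi')=0$ and $w(i)w(i+1)\cdots\models\varphi'$.
   Context: Classical LTL over a finite set $AP$ of atomic propositions, interpreted over infinite words $w\in(2^{AP})^\omega$: $w,i\models a$ iff $a\in w(i)$, $\land$ as usual, $w,i\models\mathbf{F}\varphi$ iff $\exists j\ge i$: $w,j\models\varphi$, $w,i\models\mathbf{G}\varphi$ iff $\forall j\ge i$: $w,j\models\varphi$; $w\models\varphi$ means $w,0\models\varphi$. $\mathrm{LTL}(\mathbf{F},\mathbf{G},\land)$: formulas built from $\mathrm{true}$, atomic propositions, $\land,\mathbf{F},\mathbf{G}$ (conjunctions read up to associativity/commutativity). Pseudo-atomic: a conjunction of atomic propositions (empty = $\mathrm{true}$); $\mathrm{prop}(\bigwedge_{a\in A}a)=A$. A formula is flat if it has the form $\psi\land\mathbf{G}\psi'\land\bigwedge_{i\in I}\mathbf{G}\mathbf{F}\psi''_i\land\bigwedge_{j\in J}\mathbf{F}\varphi_j$ with $\psi,\psi',\psi''_i$ pseudo-atomic and each $\varphi_j$ flat. Unfolding: $\mathfrak U(\mathrm{true})=\{\mathrm{true}\}$,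 $\mathfrak U(a)=\{a\}$, $\mathfrak U(\mathbf G\varphi)=\{\mathbf G\varphi\}$, $\mathfrak U(\varphi_1\land\varphi_2)=\{\psi_1\land\psi_2:\psi_k\in\mathfrak U(\varphi_k)\}$, $\mathfrak U(\mathbf F\varphi)=\{\mathbf F\varphi\}\cup\mathfrak U(\varphi)$. For $A\subseteq AP$ and flat $\varphi=\psi\land\mathbf{G}\psi'\land\bigwedge_I\mathbf{GF}\psi''_i\land\bigwedge_J\mathbf{F}\varphi_j$, let $\varphi[A]=\mathbf{G}\psi'\land\bigwedge_I\mathbf{GF}\psi''_i\land\bigwedge_J\mathbf{F}\varphi_j$ if $\mathrm{prop}(\psi\land\psi')\subseteq A$, and $\varphi[A]=\mathrm{false}$ otherwise. $\mathcal A$ denotes the transition system whose states are the flat formulas of $\mathrm{LTL}(\mathbf F,\mathbf G,\land)$, with alphabet $2^{AP}$ and a transition $\psi\xrightarrow{A}\psi'$ iff there is $\psi''\in\mathfrak U(\psi)$ with $\psi'=\psi''[A]\neq\mathrm{false}$; $\psi\xrightarrow{A_1\cdots A_k}\psi'$ denotes a path of such transitions (the empty path when $k=0$). $\#_{\mathbf F}$ counts $\mathbf F$ operators: $\#_{\mathbf F}(\mathrm{true})=\#_{\mathbf F}(a)=\#_{\mathbf F}(\mathbf G\varphi)=0$, $\#_{\mathbf F}(\varphi_1\land\varphi_2)=\#_{\mathbf F}(\varphi_1)+\#_{\mathbf F}(\varphi_2)$, $\#_{\mathbf F}(\mathbf F\varphi)=1+\#_{\mathbf F}(\varphi)$. 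-}

module Defs where

open import Data.Nat using (ℕ; zero; suc; _+_; _≤_)
open import Data.Fin using (Fin)
open import Data.Fin.Subset using (Subset; _∈_)
open import Data.Fin.Subset.Properties using (_∈?_)
open import Data.List using (List; []; _∷_; _++_; map; upTo)
open import Data.List.Relation.Unary.All using (all?)
open import Data.Maybe using (Maybe; just; nothing)
open import Data.Product using (_×_; ∃)
open import Data.Unit using (⊤)
open import Relation.Nullary using (yes; no)
open import Relation.Binary.PropositionalEquality using (_≡_)

variable
  n : ℕ

Letter : ℕ → Set
Letter n = Subset n

Word : ℕ → Set
Word n = ℕ → Letter n

data LTL (n : ℕ) : Set where
  true : LTL n
  atom : Fin n → LTL n
  _∧_  : LTL n → LTL n → LTL n
  F    : LTL n → LTL n
  G    : LTL n → LTL n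

infixr 5 _∧_

_,_⊨_ : Word n → ℕ → LTL n → Set
w , i ⊨ true     = ⊤
w , i ⊨ atom a   = a ∈ w i
w , i ⊨ (φ ∧ ψ)  = (w , i ⊨ φ) × (w , i ⊨ ψ)
w , i ⊨ F φ      = ∃ λ j → i ≤ j × (w , j ⊨ φ)
w , i ⊨ G φ      = ∀ j → i ≤ j → w , j ⊨ φ

_⊨_ : Word n → LTL n → Set
w ⊨ φ = w , 0 ⊨ φ

#F : LTL n → ℕ
#F true     = 0
#F (atom a) = 0
#F (φ ∧ ψ)  = #F φ + #F ψ
#F (F φ)    = suc (#F φ)
#F (G φ)    = 0

suffix : Word n → ℕ → Word n
suffix w i k = w (i + k)

prefix : Word n → ℕ → List (Letter n)
prefix w i = map w (upTo i)

-- Pseudo-atomic formulas are represented by their set prop(ψ) (as a list);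
-- the empty list is true.
pa : List (Fin n) → LTL n
pa []       = true
pa (a ∷ as) = atom a ∧ pa as

⋀ : List (LTL n) → LTL n
⋀ []       = true
⋀ (φ ∷ φs) = φ ∧ ⋀ φs

-- Flat formulas  ψ ∧ G ψ' ∧ ⋀_I GF ψ''_i ∧ ⋀_J F φ_j  (up to AC).
data Flat (n : ℕ) : Set where
  flat : (ψ ψ' : List (Fin n)) (gf : List (List (Fin n))) (ev : List (Flat n)) → Flat n

mutual
  ⟦_⟧ : Flat n → LTL n
  ⟦ flat ψ ψ' gf ev ⟧ = pa ψ ∧ G (pa ψ') ∧ ⋀ (map (λ χ → G (F (pa χ))) gf) ∧ ⋀ (⟦F⟧s ev)

  ⟦F⟧s : List (Flat n) → List (LTL n)
  ⟦F⟧s []       = []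
  ⟦F⟧s (φ ∷ φs) = F ⟦ φ ⟧ ∷ ⟦F⟧s φs

_⊕_ : Flat n → Flat n → Flat n
flat a b c d ⊕ flat a' b' c' d' = flat (a ++ a') (b ++ b') (c ++ c') (d ++ d')

emp : Flat n
emp = flat [] [] [] []

-- Unfolding: Unf φ χ  means  χ ∈ 𝔘(φ) (read as a flat formula up to AC).
mutual
  data Unf {n : ℕ} : Flat n → Flat n → Set where
    unf : ∀ {ψ ψ' gf ev c} → UnfF ev c → Unf (flat ψ ψ' gf ev) (flat ψ ψ' gf [] ⊕ c)

  data UnfF {n : ℕ} : List (Flat n) → Flat n → Set where
    []     : UnfF [] emp
    keep   : ∀ {φ φs c} → UnfF φs c → UnfF (φ ∷ φs) (flat [] [] [] (φ ∷ []) ⊕ c)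
    unfold : ∀ {φ φs χ c} → Unf φ χ → UnfF φs c → UnfF (φ ∷ φs) (χ ⊕ c)

-- φ[A]  (nothing represents false)
_[_] : Flat n → Letter n → Maybe (Flat n)
flat ψ ψ' gf ev [ A ] with all? (_∈? A) (ψ ++ ψ')
... | yes _ = just (flat [] ψ' gf ev)
... | no  _ = nothing

data _─[_]→_ {n : ℕ} : Flat n → Letter n → Flat n → Set where
  step : ∀ {φ A χ φ'} → Unf φ χ → χ [ A ] ≡ just φ' → φ ─[ A ]→ φ'

data _─[_]→*_ {n : ℕ} : Flat n → List (Letter n) → Flat n → Set where
  ε   : ∀ {φ} → φ ─[ [] ]→* φ
  _◅_ : ∀ {φ A φ' As φ''} → φ ─[ A ]→ φ' → φ' ─[ As ]→* φ'' → φ ─[ A ∷ As ]→* φ''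

-- Each F-conjunct of a flat formula that holds at position i has its witness either at i, and
-- is then unfolded, or later, and is then kept; removing the pseudo-atomic part, which the
-- letter w(i) must satisfy, is exactly one transition of 𝒜.  Reading the unfolding off the
-- witnesses of a model gives (1).  For (2), fix witnesses of all nested eventualities below a
-- common horizon N (Sat): transitions preserve this while the horizon approaches, so after N
-- steps no eventuality is left and the state is F-free.  The converses hold because every
-- transition is sound.
module Submission where

open import Defs
open import Data.Nat using (ℕ; zero; suc; _≤_; _<_; _⊔_; s≤s)
open import Data.Nat.Properties
  using (≤-refl; ≤-trans; n≤1+n; m≤n⇒m<n∨m≡n; m≤m⊔n; m≤n⊔m; m≤n⇒m≤n⊔o)
-- Pairs are written _,,_ because _,_ would make  w , i ⊨ φ  ambiguous.
open import Data.Product using (_×_; ∃; ∃₂; proj₁; proj₂) renaming (_,_ to _,,_)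
open import Data.Sum using (inj₁; inj₂)
open import Data.Unit using (⊤; tt)
open import Data.Empty using (⊥-elim)
open import Data.List using (List; []; _∷_; _++_; map; applyUpTo)
open import Data.List.Properties using (map-upTo)
open import Data.List.Relation.Unary.All using (All; []; _∷_; all?)
open import Data.List.Relation.Unary.All.Properties using (++⁺; ++⁻ˡ; ++⁻ʳ)
open import Data.Fin using (Fin)
open import Data.Fin.Subset using (_∈_)
open import Data.Fin.Subset.Properties using (_∈?_)
open import Data.Maybe using (just)
open import Function.Bundles using (_⇔_; mk⇔)
open import Relation.Nullary using (yes; no)
open import Relation.Binary.PropositionalEquality using (_≡_; refl; sym; subst)

private
  variable
    A : Set
    i j N : ℕ
    w : Word n

⊨suffix⁺ : ∀ χ → w , suc i ⊨ χ → suffix w 1 , i ⊨ χ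
⊨suffix⁺ true     s                      = tt
⊨suffix⁺ (atom a) s                      = s
⊨suffix⁺ (χ ∧ ψ)  (s ,, t)               = ⊨suffix⁺ χ s ,, ⊨suffix⁺ ψ t
⊨suffix⁺ (F χ)    (suc j ,, s≤s le ,, s) = j ,, le ,, ⊨suffix⁺ χ s
⊨suffix⁺ (G χ)    g                      = λ j le → ⊨suffix⁺ χ (g (suc j) (s≤s le))

⊨suffix⁻ : ∀ χ → suffix w 1 , i ⊨ χ → w , suc i ⊨ χ
⊨suffix⁻ true     s              = tt
⊨suffix⁻ (atom a) s              = s
⊨suffix⁻ (χ ∧ ψ)  (s ,, t)       = ⊨suffix⁻ χ s ,, ⊨suffix⁻ ψ t
⊨suffix⁻ (F χ)    (j ,, le ,, s) = suc j ,, s≤s le ,, ⊨suffix⁻ χ s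
⊨suffix⁻ (G χ)    g              = λ { (suc j) (s≤s le) → ⊨suffix⁻ χ (g j le) }

⊨F-pred : ∀ χ → w , suc i ⊨ F χ → w , i ⊨ F χ
⊨F-pred {i = i} _ (j ,, le ,, s) = j ,, ≤-trans (n≤1+n i) le ,, s

⊨G-suc : ∀ χ → w , i ⊨ G χ → w , suc i ⊨ G χ
⊨G-suc {i = i} _ g j le = g j (≤-trans (n≤1+n i) le)

⊨G-pred : ∀ χ → w , i ⊨ χ → w , suc i ⊨ G χ → w , i ⊨ G χ
⊨G-pred _ s g j le with m≤n⇒m<n∨m≡n le
... | inj₁ i<j  = g j i<j
... | inj₂ refl = s

⊨GF-pred : ∀ χ → w , suc i ⊨ G (F χ) → w , i ⊨ G (F χ)
⊨GF-pred {i = i} χ g = ⊨G-pred (F χ) (⊨F-pred χ (g (suc i) ≤-refl)) g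

module _ (w : Word n) where

  ⊨pa⇒All : ∀ xs → w , i ⊨ pa xs → All (_∈ w i) xs
  ⊨pa⇒All []       tt       = []
  ⊨pa⇒All (x ∷ xs) (a ,, p) = a ∷ ⊨pa⇒All xs p

  All⇒⊨pa : ∀ xs → All (_∈ w i) xs → w , i ⊨ pa xs
  All⇒⊨pa []       []       = tt
  All⇒⊨pa (x ∷ xs) (a ∷ as) = a ,, All⇒⊨pa xs as

  ⊨pa-++⁻ : ∀ xs {ys} → w , i ⊨ pa (xs ++ ys) → (w , i ⊨ pa xs) × (w , i ⊨ pa ys)
  ⊨pa-++⁻ xs p = All⇒⊨pa xs (++⁻ˡ xs q) ,, All⇒⊨pa _ (++⁻ʳ xs q)
    where q = ⊨pa⇒All (xs ++ _) p

  ⊨pa-++⁺ : ∀ xs {ys} → w , i ⊨ pa xs → w , i ⊨ pa ys → w , i ⊨ pa (xs ++ ys)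
  ⊨pa-++⁺ xs {ys} p q = All⇒⊨pa (xs ++ ys) (++⁺ (⊨pa⇒All xs p) (⊨pa⇒All ys q))

  ⊨⋀map-++⁻ : (f : A → LTL n) → ∀ xs {ys} →
    w , i ⊨ ⋀ (map f (xs ++ ys)) → (w , i ⊨ ⋀ (map f xs)) × (w , i ⊨ ⋀ (map f ys))
  ⊨⋀map-++⁻ f []       s        = tt ,, s
  ⊨⋀map-++⁻ f (x ∷ xs) (s ,, t) with ⊨⋀map-++⁻ f xs t
  ... | t₁ ,, t₂ = (s ,, t₁) ,, t₂

  ⊨⋀map-++⁺ : (f : A → LTL n) → ∀ xs {ys} →
    w , i ⊨ ⋀ (map f xs) → w , i ⊨ ⋀ (map f ys) → w , i ⊨ ⋀ (map f (xs ++ ys))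
  ⊨⋀map-++⁺ f []       _        t = t
  ⊨⋀map-++⁺ f (x ∷ xs) (s ,, s′) t = s ,, ⊨⋀map-++⁺ f xs s′ t

  ⊨⋀F-++⁻ : ∀ φs {ψs} →
    w , i ⊨ ⋀ (⟦F⟧s (φs ++ ψs)) → (w , i ⊨ ⋀ (⟦F⟧s φs)) × (w , i ⊨ ⋀ (⟦F⟧s ψs))
  ⊨⋀F-++⁻ []       s        = tt ,, s
  ⊨⋀F-++⁻ (φ ∷ φs) (s ,, t) with ⊨⋀F-++⁻ φs t
  ... | t₁ ,, t₂ = (s ,, t₁) ,, t₂

  ⊨⋀F-++⁺ : ∀ φs {ψs} →
    w , i ⊨ ⋀ (⟦F⟧s φs) → w , i ⊨ ⋀ (⟦F⟧s ψs) → w , i ⊨ ⋀ (⟦F⟧s (φs ++ ψs))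
  ⊨⋀F-++⁺ []       _        t = t
  ⊨⋀F-++⁺ (φ ∷ φs) (s ,, s′) t = s ,, ⊨⋀F-++⁺ φs s′ t

  ⊨⊕⁻ : ∀ φ ψ → w , i ⊨ ⟦ φ ⊕ ψ ⟧ → (w , i ⊨ ⟦ φ ⟧) × (w , i ⊨ ⟦ ψ ⟧)
  ⊨⊕⁻ (flat a₁ a₂ a₃ a₄) (flat b₁ b₂ b₃ b₄) (p ,, g ,, h ,, e)
    with ⊨pa-++⁻ a₁ p | ⊨⋀map-++⁻ _ a₃ h | ⊨⋀F-++⁻ a₄ e
  ... | p₁ ,, p₂ | h₁ ,, h₂ | e₁ ,, e₂ =
    (p₁ ,, (λ j le → proj₁ (g-split j le)) ,, h₁ ,, e₁) ,,
    (p₂ ,, (λ j le → proj₂ (g-split j le)) ,, h₂ ,, e₂)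
    where g-split = λ j le → ⊨pa-++⁻ a₂ (g j le)

  ⊨⊕⁺ : ∀ φ ψ → w , i ⊨ ⟦ φ ⟧ → w , i ⊨ ⟦ ψ ⟧ → w , i ⊨ ⟦ φ ⊕ ψ ⟧
  ⊨⊕⁺ (flat a₁ a₂ a₃ a₄) (flat b₁ b₂ b₃ b₄) (p ,, g ,, h ,, e) (p′ ,, g′ ,, h′ ,, e′) =
    ⊨pa-++⁺ a₁ p p′ ,, (λ j le → ⊨pa-++⁺ a₂ (g j le) (g′ j le))
      ,, ⊨⋀map-++⁺ _ a₃ h h′ ,, ⊨⋀F-++⁺ a₄ e e′

  mutual
    Unf-sound : ∀ {φ χ} → Unf φ χ → w , i ⊨ ⟦ χ ⟧ → w , i ⊨ ⟦ φ ⟧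
    Unf-sound (unf {ψ} {ψ′} {gf} {c = c} u) s with ⊨⊕⁻ (flat ψ ψ′ gf []) c s
    ... | (p ,, g ,, h ,, _) ,, t = p ,, g ,, h ,, UnfF-sound u t

    UnfF-sound : ∀ {φs χ} → UnfF φs χ → w , i ⊨ ⟦ χ ⟧ → w , i ⊨ ⋀ (⟦F⟧s φs)
    UnfF-sound [] _ = tt
    UnfF-sound (keep {φ} {c = c} u) s with ⊨⊕⁻ (flat [] [] [] (φ ∷ [])) c s
    ... | (_ ,, _ ,, _ ,, f ,, _) ,, t = f ,, UnfF-sound u t
    UnfF-sound {i = i} (unfold {χ = χ} {c} u us) s with ⊨⊕⁻ χ c s
    ... | s₁ ,, t = (i ,, ≤-refl ,, Unf-sound u s₁) ,, UnfF-sound us t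

  ⊨⋀map-transfer : (f : A → LTL n) → (∀ x → w , i ⊨ f x → w , j ⊨ f x) →
    ∀ xs → w , i ⊨ ⋀ (map f xs) → w , j ⊨ ⋀ (map f xs)
  ⊨⋀map-transfer f t []       _        = tt
  ⊨⋀map-transfer f t (x ∷ xs) (s ,, s′) = t x s ,, ⊨⋀map-transfer f t xs s′

  ⊨⋀F-pred : ∀ φs → w , suc i ⊨ ⋀ (⟦F⟧s φs) → w , i ⊨ ⋀ (⟦F⟧s φs)
  ⊨⋀F-pred []       _        = tt
  ⊨⋀F-pred (φ ∷ φs) (s ,, s′) = ⊨F-pred ⟦ φ ⟧ s ,, ⊨⋀F-pred φs s′

  bracket-sound : ∀ χ {φ′} → χ [ w i ] ≡ just φ′ → w , suc i ⊨ ⟦ φ′ ⟧ → w , i ⊨ ⟦ χ ⟧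
  bracket-sound {i} (flat ψ ψ′ gf ev) eq s with all? (_∈? w i) (ψ ++ ψ′)
  bracket-sound (flat ψ ψ′ gf ev) refl (_ ,, g ,, h ,, e) | yes now =
    All⇒⊨pa ψ (++⁻ˡ ψ now) ,, ⊨G-pred (pa ψ′) (All⇒⊨pa ψ′ (++⁻ʳ ψ now)) g
      ,, ⊨⋀map-transfer _ (λ x → ⊨GF-pred (pa x)) gf h ,, ⊨⋀F-pred ev e
  bracket-sound (flat ψ ψ′ gf ev) () _ | no _

  step-sound : ∀ {φ φ′} → φ ─[ w i ]→ φ′ → w , suc i ⊨ ⟦ φ′ ⟧ → w , i ⊨ ⟦ φ ⟧
  step-sound (step {χ = χ} u eq) s = Unf-sound u (bracket-sound χ eq s)

  mutual
    Sat : ℕ → ℕ → Flat n → Set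
    Sat i N (flat ψ ψ′ gf ev) = (w , i ⊨ ⟦ flat ψ ψ′ gf [] ⟧) × Fulfilled i N ev

    Fulfilled : ℕ → ℕ → List (Flat n) → Set
    Fulfilled i N []       = ⊤
    Fulfilled i N (φ ∷ φs) = (∃ λ j → i ≤ j × j < N × Sat j N φ) × Fulfilled i N φs

  mutual
    Sat-sound : ∀ φ → Sat i N φ → w , i ⊨ ⟦ φ ⟧
    Sat-sound (flat _ _ _ ev) ((p ,, g ,, h ,, _) ,, f) = p ,, g ,, h ,, Fulfilled-sound ev f

    Fulfilled-sound : ∀ φs → Fulfilled i N φs → w , i ⊨ ⋀ (⟦F⟧s φs)
    Fulfilled-sound []       _                             = tt
    Fulfilled-sound (φ ∷ φs) ((j ,, i≤j ,, _ ,, s) ,, f) =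
      (j ,, i≤j ,, Sat-sound φ s) ,, Fulfilled-sound φs f

  mutual
    Sat-mono : ∀ φ {N N′} → N ≤ N′ → Sat i N φ → Sat i N′ φ
    Sat-mono (flat _ _ _ ev) le (c ,, f) = c ,, Fulfilled-mono ev le f

    Fulfilled-mono : ∀ φs {N N′} → N ≤ N′ → Fulfilled i N φs → Fulfilled i N′ φs
    Fulfilled-mono []       le _ = tt
    Fulfilled-mono (φ ∷ φs) le ((j ,, i≤j ,, j<N ,, s) ,, f) =
      (j ,, i≤j ,, ≤-trans j<N le ,, Sat-mono φ le s) ,, Fulfilled-mono φs le f

  mutual
    Sat-complete : ∀ φ → w , i ⊨ ⟦ φ ⟧ → ∃ λ N → Sat i N φ
    Sat-complete (flat _ _ _ ev) (p ,, g ,, h ,, e) with Fulfilled-complete ev e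
    ... | N ,, f = N ,, (p ,, g ,, h ,, tt) ,, f

    Fulfilled-complete : ∀ φs → w , i ⊨ ⋀ (⟦F⟧s φs) → ∃ λ N → Fulfilled i N φs
    Fulfilled-complete []       _ = 0 ,, tt
    Fulfilled-complete (φ ∷ φs) ((j ,, i≤j ,, s) ,, e)
      with Sat-complete {i = j} φ s | Fulfilled-complete φs e
    ... | M ,, sat | K ,, f =
      suc j ⊔ M ⊔ K ,,
      (j ,, i≤j ,, m≤n⇒m≤n⊔o K (m≤m⊔n (suc j) M) ,,
       Sat-mono φ (m≤n⇒m≤n⊔o K (m≤n⊔m (suc j) M)) sat)
      ,, Fulfilled-mono φs (m≤n⊔m (suc j ⊔ M) K) f

  Fulfilled-++⁺ : ∀ φs {ψs} → Fulfilled i N φs → Fulfilled i N ψs → Fulfilled i N (φs ++ ψs)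
  Fulfilled-++⁺ []       _        f = f
  Fulfilled-++⁺ (φ ∷ φs) (s ,, f′) f = s ,, Fulfilled-++⁺ φs f′ f

  ⊨emp : w , i ⊨ ⟦ emp ⟧
  ⊨emp = tt ,, (λ _ _ → tt) ,, tt ,, tt

  SatLater : ℕ → ℕ → Flat n → Set
  SatLater i N (flat ψ ψ′ gf ev) = (w , i ⊨ ⟦ flat ψ ψ′ gf [] ⟧) × Fulfilled (suc i) N ev

  SatLater-⊕ : ∀ φ ψ → SatLater i N φ → SatLater i N ψ → SatLater i N (φ ⊕ ψ)
  SatLater-⊕ (flat a₁ a₂ a₃ a₄) (flat b₁ b₂ b₃ b₄) (c ,, f) (c′ ,, f′) =
    ⊨⊕⁺ (flat a₁ a₂ a₃ []) (flat b₁ b₂ b₃ []) c c′ ,, Fulfilled-++⁺ a₄ f f′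

  mutual
    Unf-complete : ∀ φ → Sat i N φ → ∃ λ χ → Unf φ χ × SatLater i N χ
    Unf-complete (flat ψ ψ′ gf ev) (c ,, f) with UnfF-complete ev f
    ... | χ ,, u ,, later =
      flat ψ ψ′ gf [] ⊕ χ ,, unf u ,, SatLater-⊕ (flat ψ ψ′ gf []) χ (c ,, tt) later

    UnfF-complete : ∀ φs → Fulfilled i N φs → ∃ λ χ → UnfF φs χ × SatLater i N χ
    UnfF-complete []       _ = emp ,, [] ,, ⊨emp ,, tt
    UnfF-complete (φ ∷ φs) ((j ,, i≤j ,, j<N ,, s) ,, f)
      with UnfF-complete φs f | m≤n⇒m<n∨m≡n i≤j
    ... | χ ,, u ,, later | inj₁ i<j =
      flat [] [] [] (φ ∷ []) ⊕ χ ,, keep u ,,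
      SatLater-⊕ (flat [] [] [] (φ ∷ [])) χ (⊨emp ,, (j ,, i<j ,, j<N ,, s) ,, tt) later
    ... | χ ,, u ,, later | inj₂ refl with Unf-complete φ s
    ...   | χ′ ,, u′ ,, later′ = χ′ ⊕ χ ,, unfold u′ u ,, SatLater-⊕ χ′ χ later′ later

  bracket-complete : ∀ χ → SatLater i N χ →
    ∃ λ φ′ → χ [ w i ] ≡ just φ′ × Sat (suc i) N φ′
  bracket-complete {i} (flat ψ ψ′ gf ev) ((p ,, g ,, h ,, _) ,, f) with all? (_∈? w i) (ψ ++ ψ′)
  ... | yes _   =
    flat [] ψ′ gf ev ,, refl ,,
    (tt ,, ⊨G-suc (pa ψ′) g ,, ⊨⋀map-transfer _ (λ x → ⊨G-suc (F (pa x))) gf h ,, tt) ,, f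
  ... | no ¬now = ⊥-elim (¬now (++⁺ (⊨pa⇒All ψ p) (⊨pa⇒All ψ′ (g i ≤-refl))))

  step-complete : ∀ φ → Sat i N φ → ∃ λ φ′ → φ ─[ w i ]→ φ′ × Sat (suc i) N φ′
  step-complete φ s with Unf-complete φ s
  ... | χ ,, u ,, later with bracket-complete χ later
  ...   | φ′ ,, eq ,, s′ = φ′ ,, step u eq ,, s′

mutual
  Sat-shift : ∀ φ → Sat w (suc i) (suc N) φ → Sat (suffix w 1) i N φ
  Sat-shift (flat ψ ψ′ gf ev) (c ,, f) = ⊨suffix⁺ ⟦ flat ψ ψ′ gf [] ⟧ c ,, Fulfilled-shift ev f

  Fulfilled-shift : ∀ φs → Fulfilled w (suc i) (suc N) φs → Fulfilled (suffix w 1) i N φs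
  Fulfilled-shift []       _ = tt
  Fulfilled-shift (φ ∷ φs) ((suc j ,, s≤s i≤j ,, s≤s j<N ,, s) ,, f) =
    (j ,, i≤j ,, j<N ,, Sat-shift φ s) ,, Fulfilled-shift φs f

#F-pa : ∀ (xs : List (Fin n)) → #F (pa xs) ≡ 0
#F-pa []       = refl
#F-pa (_ ∷ xs) = #F-pa xs

#F-⋀G : ∀ (f : A → LTL n) xs → #F (⋀ (map (λ x → G (f x)) xs)) ≡ 0
#F-⋀G f []       = refl
#F-⋀G f (_ ∷ xs) = #F-⋀G f xs

#F-no-eventualities : ∀ ψ ψ′ (gf : List (List (Fin n))) → #F ⟦ flat ψ ψ′ gf [] ⟧ ≡ 0
#F-no-eventualities ψ ψ′ gf rewrite #F-pa ψ | #F-⋀G (λ χ → F (pa χ)) gf = refl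

-- Runs along w are peeled one letter at a time: applyUpTo w (suc m) is w 0 ∷ applyUpTo (suffix w 1) m
-- and suffix (suffix w 1) m is suffix w (suc m), both definitionally.
Sat⇒F-free-run : ∀ N (w : Word n) φ → Sat w 0 N φ →
  ∃₂ λ m φ′ → (φ ─[ applyUpTo w m ]→* φ′) × (#F ⟦ φ′ ⟧ ≡ 0) × (suffix w m ⊨ ⟦ φ′ ⟧)
Sat⇒F-free-run zero    w (flat ψ ψ′ gf []) s =
  0 ,, _ ,, ε ,, #F-no-eventualities ψ ψ′ gf ,, Sat-sound w {N = 0} (flat ψ ψ′ gf []) s
Sat⇒F-free-run zero    w (flat _ _ _ (_ ∷ _)) (_ ,, (_ ,, _ ,, () ,, _) ,, _)
Sat⇒F-free-run (suc N) w φ s with step-complete w φ s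
... | φ′ ,, st ,, s′ with Sat⇒F-free-run N (suffix w 1) φ′ (Sat-shift φ′ s′)
...   | m ,, φ″ ,, run ,, noF ,, t = suc m ,, φ″ ,, st ◅ run ,, noF ,, t

run-sound : ∀ m (w : Word n) {φ φ′} →
  φ ─[ applyUpTo w m ]→* φ′ → suffix w m ⊨ ⟦ φ′ ⟧ → w ⊨ ⟦ φ ⟧
run-sound zero    w ε          s = s
run-sound (suc m) w (st ◅ run) s = step-sound w st (⊨suffix⁻ _ (run-sound m (suffix w 1) run s))

lemma1 : ∀ {n : ℕ} (φ : Flat n) (w : Word n) →
    ((w ⊨ ⟦ φ ⟧) ⇔ (∃ λ φ' → (φ ─[ w 0 ]→ φ') × (suffix w 1 ⊨ ⟦ φ' ⟧)))
    × ((w ⊨ ⟦ φ ⟧) ⇔ (∃₂ λ i φ' → (φ ─[ prefix w i ]→* φ') × (#F ⟦ φ' ⟧ ≡ 0) × (suffix w i ⊨ ⟦ φ' ⟧)))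
lemma1 φ w = mk⇔ to-step from-step ,, mk⇔ to-run from-run
  where
    to-step : w ⊨ ⟦ φ ⟧ → ∃ λ φ′ → (φ ─[ w 0 ]→ φ′) × (suffix w 1 ⊨ ⟦ φ′ ⟧)
    to-step s with Sat-complete w φ s
    ... | N ,, sat with step-complete w φ sat
    ...   | φ′ ,, st ,, sat′ = φ′ ,, st ,, ⊨suffix⁺ ⟦ φ′ ⟧ (Sat-sound w φ′ sat′)

    from-step : (∃ λ φ′ → (φ ─[ w 0 ]→ φ′) × (suffix w 1 ⊨ ⟦ φ′ ⟧)) → w ⊨ ⟦ φ ⟧
    from-step (φ′ ,, st ,, s) = step-sound w st (⊨suffix⁻ ⟦ φ′ ⟧ s)

    to-run : w ⊨ ⟦ φ ⟧ →
      ∃₂ λ m φ′ → (φ ─[ prefix w m ]→* φ′) × (#F ⟦ φ′ ⟧ ≡ 0) × (suffix w m ⊨ ⟦ φ′ ⟧)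
    to-run s with Sat-complete w φ s
    ... | N ,, sat with Sat⇒F-free-run N w φ sat
    ...   | m ,, φ′ ,, run ,, noF ,, t =
      m ,, φ′ ,, subst (φ ─[_]→* φ′) (sym (map-upTo w m)) run ,, noF ,, t

    from-run : (∃₂ λ m φ′ → (φ ─[ prefix w m ]→* φ′) × (#F ⟦ φ′ ⟧ ≡ 0) × (suffix w m ⊨ ⟦ φ′ ⟧)) →
      w ⊨ ⟦ φ ⟧
    from-run (m ,, φ′ ,, run ,, _ ,, s) = run-sound m w (subst (φ ─[_]→* φ′) (map-upTo w m) run) s
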